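{- Let $\Pi(k,j) = k(k+1)(k+j)(k+j+1)$. (a) Let $\ell \geq 1$ be an integer, let $a_t = 2^{2t}\frac{(\ell+t)!}{(2t+1)!(\ell-t)!}(2\ell+1)$ and $b_t = 2^{2t}\binom{\ell+t}{2t}$ for $0 \leq t \leq \ell$, let $A(k) = \sum_{t=0}^{\ell} a_t k^t$, $B(k) = \sum_{t=0}^{\ell} b_t k^t$, and define the polynomial $j_{2\ell}(k) = k\,A(k)^2 - k$, so that $k + j_{2\ell}(k) + 1 = kA(k)^2 + 1 = (k+1)B(k)^2$. (b) Let $\ell \geq 0$ be an integer, let $a_t = 2^{2t+1}\binom{\ell+t+1}{2t+1}$ for $0 \leq t \leq \ell$, $b_0 = 1$ and $b_t = 2^{2t-1}\binom{\ell+t}{2t-1}\frac{\ell+1}{t}$ for $1 \leq t \leq \ell+1$, let $A(k) = \sum_{t=0}^{\ell} a_t k^t$, $B(k) = \sum_{t=0}^{\ell+1} b_t k^t$, and define $j_{2\ell+1}(k) = k(k+1)A(k)^2 - k$, so that $k + j_{2\ell+1}(k) + 1 = k(k+1)A(k)^2 + 1 = B(k)^2$. Then in both cases, for every positive integer $k$, $j_i(k)$ ($i = 2\ell$ resp. $i = 2\ell+1$) is a nonnegative integer and the pair $(k, j_i(k))$ is square, namely $\Pi(k, j_i(k)) = \big[k(k+1)A(k)B(k)\big]^2$.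
   Context: A pair $(k,j)$ of nonnegative integers is called square if the quadratic number $\Pi(k,j) = k(k+1)(k+j)(k+j+1)$ is a perfect square. -}

module Defs where

open import Data.Nat as ℕ using (ℕ; zero; suc; _∸_; _!)
open import Data.Nat.Properties using (_!*_!≢0)
open import Data.Nat.Combinatorics using (_C_)
open import Data.Integer using (+_)
open import Data.Rational using (ℚ; _/_; _+_; _*_; _-_)

toℚ : ℕ → ℚ
toℚ n = (+ n) / 1

-- Σ_{t=0}^{n} f t  (inclusive upper bound)
sumTo : ℕ → (ℕ → ℚ) → ℚ
sumTo zero    f = f 0
sumTo (suc n) f = sumTo n f + f (suc n)

Π : ℚ → ℚ → ℚ
Π k j = k * (k + toℚ 1) * (k + j) * (k + j + toℚ 1)

aEven : ℕ → ℕ → ℚ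
aEven ℓ t = ((+ (2 ℕ.^ (2 ℕ.* t) ℕ.* (ℓ ℕ.+ t) ! ℕ.* (2 ℕ.* ℓ ℕ.+ 1)))
              / ((2 ℕ.* t ℕ.+ 1) ! ℕ.* (ℓ ∸ t) !))
              {{(2 ℕ.* t ℕ.+ 1) !* (ℓ ∸ t) !≢0}}

bEven : ℕ → ℕ → ℚ
bEven ℓ t = toℚ (2 ℕ.^ (2 ℕ.* t) ℕ.* ((ℓ ℕ.+ t) C (2 ℕ.* t)))

AEven : ℕ → ℕ → ℚ
AEven ℓ k = sumTo ℓ (λ t → aEven ℓ t * toℚ (k ℕ.^ t))

BEven : ℕ → ℕ → ℚ
BEven ℓ k = sumTo ℓ (λ t → bEven ℓ t * toℚ (k ℕ.^ t))

jEven : ℕ → ℕ → ℚ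
jEven ℓ k = toℚ k * AEven ℓ k * AEven ℓ k - toℚ k

aOdd : ℕ → ℕ → ℚ
aOdd ℓ t = toℚ (2 ℕ.^ (2 ℕ.* t ℕ.+ 1) ℕ.* ((ℓ ℕ.+ t ℕ.+ 1) C (2 ℕ.* t ℕ.+ 1)))

-- b_0 = 1, b_t = 2^{2t-1} C(ℓ+t, 2t-1) (ℓ+1)/t  for t ≥ 1
-- (written with t = suc s, so 2t-1 = 2s+1 and ℓ+t = ℓ+s+1)
bOdd : ℕ → ℕ → ℚ
bOdd ℓ zero    = toℚ 1
bOdd ℓ (suc s) =
  (+ (2 ℕ.^ (2 ℕ.* s ℕ.+ 1) ℕ.* ((ℓ ℕ.+ suc s) C (2 ℕ.* s ℕ.+ 1)) ℕ.* (ℓ ℕ.+ 1)))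
    / suc s

AOdd : ℕ → ℕ → ℚ
AOdd ℓ k = sumTo ℓ (λ t → aOdd ℓ t * toℚ (k ℕ.^ t))

BOdd : ℕ → ℕ → ℚ
BOdd ℓ k = sumTo (suc ℓ) (λ t → bOdd ℓ t * toℚ (k ℕ.^ t))

jOdd : ℕ → ℕ → ℚ
jOdd ℓ k = toℚ k * (toℚ k + toℚ 1) * AOdd ℓ k * AOdd ℓ k - toℚ k

{-# OPTIONS --safe #-}

-- Put ε = √(k+1) + √k, a unit since (√(k+1) + √k)(√(k+1) − √k) = 1.  The pair (A, B) that
-- belongs to j_i is read off from ε^(i+1), which is B √(k+1) + A √k for even i and
-- B + A √(k(k+1)) for odd i.  Multiplication by ε gives the recurrences
--   A₂ₗ₊₁ = A₂ₗ + B₂ₗ,  B₂ₗ₊₁ = B₂ₗ + k A₂ₗ₊₁,  B₂ₗ₊₂ = B₂ₗ₊₁ + k A₂ₗ₊₁,  A₂ₗ₊₂ = B₂ₗ₊₂ + A₂ₗ₊₁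
-- (on coefficients, instances of Pascal's rule) and preserves the norm identities
-- (k+1)B² − kA² = 1 resp. B² − k(k+1)A² = 1.  Since k + j = kA² resp. k(k+1)A², these say
-- k + j + 1 = (k+1)B² resp. B², so Π(k, j) = k(k+1)(k+j)(k+j+1) = (k(k+1)AB)².  By the
-- absorption identity (m+d)Cm · d = (m+1) · (m+d)C(m+1) all coefficients are natural
-- numbers, so the computation is done in ℕ and transported to ℚ along toℚ.

module Submission where

open import Defs
open import Data.Nat using (ℕ; _≤_)
open import Data.Product using (_×_; ∃; _,_)
open import Relation.Binary.PropositionalEquality
  using (_≡_; refl; sym; trans; cong; cong₂; module ≡-Reasoning)

module Integral where

  open import Data.Nat
  open import Data.Nat.Properties
  open import Data.Nat.Combinatorics
  open import Data.Nat.DivMod using (_/_; m/n*n≡m)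
  open import Data.Nat.Tactic.RingSolver using (solve-∀; solve)
  open import Data.List.Base using (_∷_; [])
  open import Relation.Binary.PropositionalEquality using (subst)
  open import Algebra.Properties.CommutativeSemigroup +-commutativeSemigroup
    using () renaming (interchange to +-interchange)
  open import Algebra.Properties.CommutativeSemigroup *-commutativeSemigroup using (x∙yz≈y∙xz)
  open ≡-Reasoning

  [m+d]Cm*[m!*d!]≡[m+d]! : ∀ m d → ((m + d) C m) * (m ! * d !) ≡ (m + d) !
  [m+d]Cm*[m!*d!]≡[m+d]! m d = begin
    ((m + d) C m) * (m ! * d !)
      ≡⟨ cong (λ e → ((m + d) C m) * (m ! * e !)) (m+n∸m≡n m d) ⟨
    ((m + d) C m) * (m ! * (m + d ∸ m) !)
      ≡⟨ cong (_* (m ! * (m + d ∸ m) !)) (nCk≡n!/k![n-k]! m≤m+d) ⟩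
    (m + d) ! / (m ! * (m + d ∸ m) !) * (m ! * (m + d ∸ m) !)
      ≡⟨ m/n*n≡m (k![n∸k]!∣n! m≤m+d) ⟩
    (m + d) ! ∎
    where
    m≤m+d = m≤m+n m d
    instance _ = m !* (m + d ∸ m) !≢0

  [m+d]Cm*d≡[1+m]*[m+d]C[1+m] : ∀ m d → ((m + d) C m) * d ≡ suc m * ((m + d) C suc m)
  [m+d]Cm*d≡[1+m]*[m+d]C[1+m] m zero = begin
    ((m + 0) C m) * 0            ≡⟨ *-zeroʳ ((m + 0) C m) ⟩
    0                            ≡⟨ *-zeroʳ (suc m) ⟨
    suc m * 0                    ≡⟨ cong (suc m *_) (k>n⇒nCk≡0 (s≤s (≤-reflexive (+-identityʳ m)))) ⟨
    suc m * ((m + 0) C suc m)    ∎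
  [m+d]Cm*d≡[1+m]*[m+d]C[1+m] m (suc d) =
    *-cancelʳ-≡ (((m + suc d) C m) * suc d) (suc m * ((m + suc d) C suc m)) (m ! * d !) (begin
    ((m + suc d) C m) * suc d * (m ! * d !)      ≡⟨ shuffle ((m + suc d) C m) (suc d) (m !) (d !) ⟩
    ((m + suc d) C m) * (m ! * (suc d) !)        ≡⟨ [m+d]Cm*[m!*d!]≡[m+d]! m (suc d) ⟩
    (m + suc d) !                                ≡⟨ cong _! (+-suc m d) ⟩
    (suc m + d) !                                ≡⟨ [m+d]Cm*[m!*d!]≡[m+d]! (suc m) d ⟨
    ((suc m + d) C suc m) * ((suc m) ! * d !)    ≡⟨ cong (λ n → (n C suc m) * ((suc m) ! * d !)) (+-suc m d) ⟨
    ((m + suc d) C suc m) * ((suc m) ! * d !)    ≡⟨ shuffle′ ((m + suc d) C suc m) (suc m) (m !) (d !) ⟨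
    suc m * ((m + suc d) C suc m) * (m ! * d !)  ∎)
    where
    instance _ = m !* d !≢0
    shuffle : ∀ c s f g → c * s * (f * g) ≡ c * (f * (s * g))
    shuffle = solve-∀
    shuffle′ : ∀ c s f g → s * c * (f * g) ≡ c * (s * f * g)
    shuffle′ = solve-∀

  [m+d]!*[m+2d+1]≡[[m+d]Cm+2*[m+d]C[1+m]]*[[1+m]!*d!] : ∀ m d →
    (m + d) ! * (m + 2 * d + 1) ≡ ((m + d) C m + 2 * ((m + d) C suc m)) * (suc m ! * d !)
  [m+d]!*[m+2d+1]≡[[m+d]Cm+2*[m+d]C[1+m]]*[[1+m]!*d!] m d = begin
    (m + d) ! * (m + 2 * d + 1)
      ≡⟨ cong (_* (m + 2 * d + 1)) ([m+d]Cm*[m!*d!]≡[m+d]! m d) ⟨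
    c * (m ! * d !) * (m + 2 * d + 1)
      ≡⟨ expand c (m !) (d !) m d ⟩
    (c * suc m + 2 * (c * d)) * (m ! * d !)
      ≡⟨ cong (λ x → (c * suc m + 2 * x) * (m ! * d !)) ([m+d]Cm*d≡[1+m]*[m+d]C[1+m] m d) ⟩
    (c * suc m + 2 * (suc m * c′)) * (m ! * d !)
      ≡⟨ collect c c′ (m !) (d !) m ⟩
    (c + 2 * c′) * (suc m ! * d !) ∎
    where
    c = (m + d) C m
    c′ = (m + d) C suc m
    expand : ∀ c f g m d →
             c * (f * g) * (m + 2 * d + 1) ≡ (c * (1 + m) + 2 * (c * d)) * (f * g)
    expand = solve-∀
    collect : ∀ c c′ f g m →
              (c * (1 + m) + 2 * ((1 + m) * c′)) * (f * g) ≡ (c + 2 * c′) * ((1 + m) * f * g)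
    collect = solve-∀

  eval : ℕ → (ℕ → ℕ) → ℕ → ℕ
  eval zero    c k = c 0 * k ^ 0
  eval (suc n) c k = eval n c k + c (suc n) * k ^ suc n

  shift : (ℕ → ℕ) → ℕ → ℕ
  shift c zero    = 0
  shift c (suc t) = c t

  module _ (k : ℕ) where

    eval-cong : ∀ n {c d} → (∀ t → c t ≡ d t) → eval n c k ≡ eval n d k
    eval-cong zero    c≗d = cong (_* 1) (c≗d 0)
    eval-cong (suc n) c≗d = cong₂ _+_ (eval-cong n c≗d) (cong (_* k ^ suc n) (c≗d (suc n)))

    eval-+ : ∀ n c d → eval n (λ t → c t + d t) k ≡ eval n c k + eval n d k
    eval-+ zero    c d = *-distribʳ-+ 1 (c 0) (d 0)
    eval-+ (suc n) c d = begin
      eval n (λ t → c t + d t) k + (c (suc n) + d (suc n)) * k ^ suc n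
        ≡⟨ cong₂ _+_ (eval-+ n c d) (*-distribʳ-+ (k ^ suc n) (c (suc n)) (d (suc n))) ⟩
      (eval n c k + eval n d k) + (c (suc n) * k ^ suc n + d (suc n) * k ^ suc n)
        ≡⟨ +-interchange (eval n c k) (eval n d k) _ _ ⟩
      eval (suc n) c k + eval (suc n) d k ∎

    eval-shift : ∀ n c → eval (suc n) (shift c) k ≡ k * eval n c k
    eval-shift zero    c = x*[y*1]≡y*[x*1] (c 0) k
      where
      x*[y*1]≡y*[x*1] : ∀ x y → x * (y * 1) ≡ y * (x * 1)
      x*[y*1]≡y*[x*1] = solve-∀
    eval-shift (suc n) c = begin
      eval (suc n) (shift c) k + c (suc n) * (k * k ^ suc n)
        ≡⟨ cong (_+ c (suc n) * (k * k ^ suc n)) (eval-shift n c) ⟩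
      k * eval n c k + c (suc n) * (k * k ^ suc n)
        ≡⟨ cong (k * eval n c k +_) (x∙yz≈y∙xz (c (suc n)) k (k ^ suc n)) ⟩
      k * eval n c k + k * (c (suc n) * k ^ suc n)
        ≡⟨ *-distribˡ-+ k (eval n c k) (c (suc n) * k ^ suc n) ⟨
      k * eval (suc n) c k ∎

    eval-extend : ∀ n c → c (suc n) ≡ 0 → eval (suc n) c k ≡ eval n c k
    eval-extend n c cₙ₊₁≡0 =
      trans (cong (λ x → eval n c k + x * k ^ suc n) cₙ₊₁≡0) (+-identityʳ (eval n c k))

  -- The paper's a_t in (a) and b_t in (b) are quotients; aEvenℕ and bOddℕ are their integral
  -- forms (see aEven≡toℚ∘aEvenℕ and bOdd≡toℚ∘bOddℕ).
  aEvenℕ bEvenℕ aOddℕ bOddℕ : ℕ → ℕ → ℕ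
  aEvenℕ ℓ t = 2 ^ (2 * t) * ((ℓ + t) C (2 * t) + 2 * ((ℓ + t) C suc (2 * t)))
  bEvenℕ ℓ t = 2 ^ (2 * t) * ((ℓ + t) C (2 * t))
  aOddℕ  ℓ t = 2 ^ (2 * t + 1) * ((ℓ + t + 1) C (2 * t + 1))
  bOddℕ  ℓ t = bEvenℕ ℓ t + shift (aOddℕ ℓ) t

  2^[2[1+t]]≡4*2^[2t] : ∀ t → 2 ^ (2 * suc t) ≡ 4 * 2 ^ (2 * t)
  2^[2[1+t]]≡4*2^[2t] t = trans (cong (2 ^_) (*-suc 2 t)) (sym (*-assoc 2 2 (2 ^ (2 * t))))

  aOddℕ≡2*2^[2t]*[1+ℓ+t]C[1+2t] : ∀ ℓ t → aOddℕ ℓ t ≡ 2 * 2 ^ (2 * t) * (suc (ℓ + t) C suc (2 * t))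
  aOddℕ≡2*2^[2t]*[1+ℓ+t]C[1+2t] ℓ t =
    cong₂ (λ e n → 2 ^ e * (n C e)) (+-comm (2 * t) 1) (+-comm (ℓ + t) 1)

  aOddℕ≡aEvenℕ+bEvenℕ : ∀ ℓ t → aOddℕ ℓ t ≡ aEvenℕ ℓ t + bEvenℕ ℓ t
  aOddℕ≡aEvenℕ+bEvenℕ ℓ t = begin
    aOddℕ ℓ t
      ≡⟨ aOddℕ≡2*2^[2t]*[1+ℓ+t]C[1+2t] ℓ t ⟩
    2 * p * (suc (ℓ + t) C suc (2 * t))
      ≡⟨ cong (2 * p *_) (nCk+nC[k+1]≡[n+1]C[k+1] (ℓ + t) (2 * t)) ⟨
    2 * p * ((ℓ + t) C (2 * t) + (ℓ + t) C suc (2 * t))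
      ≡⟨ regroup p ((ℓ + t) C (2 * t)) ((ℓ + t) C suc (2 * t)) ⟩
    aEvenℕ ℓ t + bEvenℕ ℓ t ∎
    where
    p = 2 ^ (2 * t)
    regroup : ∀ p x y → 2 * p * (x + y) ≡ p * (x + 2 * y) + p * x
    regroup = solve-∀

  bEvenℕ-suc : ∀ ℓ t → bEvenℕ (suc ℓ) t ≡ bOddℕ ℓ t + shift (aOddℕ ℓ) t
  bEvenℕ-suc ℓ zero    = refl
  bEvenℕ-suc ℓ (suc s) = begin
    2 ^ (2 * suc s) * (suc N C (2 * suc s))
      ≡⟨ cong₂ (λ q e → q * (suc N C e)) (2^[2[1+t]]≡4*2^[2t] s) (*-suc 2 s) ⟩
    4 * p * (suc N C suc m)
      ≡⟨ cong (4 * p *_) (nCk+nC[k+1]≡[n+1]C[k+1] N m) ⟨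
    4 * p * (N C m + N C suc m)
      ≡⟨ regroup p (N C m) (N C suc m) ⟩
    4 * p * (N C suc m) + 2 * (2 * p * (N C m))
      ≡⟨ cong₂ (λ q e → q * (N C e) + 2 * (2 * p * (N C m))) (2^[2[1+t]]≡4*2^[2t] s) (*-suc 2 s) ⟨
    bEvenℕ ℓ (suc s) + 2 * (2 * p * (N C m))
      ≡⟨ cong (λ n → bEvenℕ ℓ (suc s) + 2 * (2 * p * (n C m))) (+-suc ℓ s) ⟩
    bEvenℕ ℓ (suc s) + 2 * (2 * p * (suc (ℓ + s) C m))
      ≡⟨ cong (λ a → bEvenℕ ℓ (suc s) + 2 * a) (aOddℕ≡2*2^[2t]*[1+ℓ+t]C[1+2t] ℓ s) ⟨
    bEvenℕ ℓ (suc s) + 2 * aOddℕ ℓ s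
      ≡⟨ double-+ (bEvenℕ ℓ (suc s)) (aOddℕ ℓ s) ⟩
    bOddℕ ℓ (suc s) + aOddℕ ℓ s ∎
    where
    p = 2 ^ (2 * s)
    m = suc (2 * s)
    N = ℓ + suc s
    regroup : ∀ p x y → 4 * p * (x + y) ≡ 4 * p * y + 2 * (2 * p * x)
    regroup = solve-∀
    double-+ : ∀ b a → b + 2 * a ≡ b + a + a
    double-+ = solve-∀

  aEvenℕ-suc : ∀ ℓ t → aEvenℕ (suc ℓ) t ≡ bEvenℕ (suc ℓ) t + aOddℕ ℓ t
  aEvenℕ-suc ℓ t = begin
    p * (suc (ℓ + t) C (2 * t) + 2 * (suc (ℓ + t) C suc (2 * t)))
      ≡⟨ regroup p (suc (ℓ + t) C (2 * t)) (suc (ℓ + t) C suc (2 * t)) ⟩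
    p * (suc (ℓ + t) C (2 * t)) + 2 * p * (suc (ℓ + t) C suc (2 * t))
      ≡⟨ cong (bEvenℕ (suc ℓ) t +_) (aOddℕ≡2*2^[2t]*[1+ℓ+t]C[1+2t] ℓ t) ⟨
    bEvenℕ (suc ℓ) t + aOddℕ ℓ t ∎
    where
    p = 2 ^ (2 * t)
    regroup : ∀ p x y → p * (x + 2 * y) ≡ p * x + 2 * p * y
    regroup = solve-∀

  ℓ+[1+ℓ]<2[1+ℓ] : ∀ ℓ → ℓ + suc ℓ < 2 * suc ℓ
  ℓ+[1+ℓ]<2[1+ℓ] ℓ = ≤-reflexive (cong (λ x → suc (ℓ + suc x)) (sym (+-identityʳ ℓ)))

  bEvenℕ[ℓ,1+ℓ]≡0 : ∀ ℓ → bEvenℕ ℓ (suc ℓ) ≡ 0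
  bEvenℕ[ℓ,1+ℓ]≡0 ℓ =
    trans (cong (2 ^ (2 * suc ℓ) *_) (k>n⇒nCk≡0 (ℓ+[1+ℓ]<2[1+ℓ] ℓ))) (*-zeroʳ (2 ^ (2 * suc ℓ)))

  aOddℕ[ℓ,1+ℓ]≡0 : ∀ ℓ → aOddℕ ℓ (suc ℓ) ≡ 0
  aOddℕ[ℓ,1+ℓ]≡0 ℓ =
    trans (cong (2 ^ (2 * suc ℓ + 1) *_) (k>n⇒nCk≡0 (+-monoˡ-< 1 (ℓ+[1+ℓ]<2[1+ℓ] ℓ))))
          (*-zeroʳ (2 ^ (2 * suc ℓ + 1)))

  aEven-numerator≡aEvenℕ*denominator : ∀ t d →
    2 ^ (2 * t) * (t + d + t) ! * (2 * (t + d) + 1) ≡ aEvenℕ (t + d) t * ((2 * t + 1) ! * (t + d ∸ t) !)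
  aEven-numerator≡aEvenℕ*denominator t d = begin
    p * (t + d + t) ! * (2 * (t + d) + 1)
      ≡⟨ cong₂ (λ n r → p * n ! * r) N≡m+d 2[t+d]+1≡2t+2d+1 ⟩
    p * (m + d) ! * (m + 2 * d + 1)
      ≡⟨ *-assoc p ((m + d) !) (m + 2 * d + 1) ⟩
    p * ((m + d) ! * (m + 2 * d + 1))
      ≡⟨ cong (p *_) ([m+d]!*[m+2d+1]≡[[m+d]Cm+2*[m+d]C[1+m]]*[[1+m]!*d!] m d) ⟩
    p * (((m + d) C m + 2 * ((m + d) C suc m)) * (suc m ! * d !))
      ≡⟨ *-assoc p _ (suc m ! * d !) ⟨
    p * ((m + d) C m + 2 * ((m + d) C suc m)) * (suc m ! * d !)
      ≡⟨ cong₂ (λ n e → p * (n C m + 2 * (n C suc m)) * (suc m ! * e !)) N≡m+d (m+n∸m≡n t d) ⟨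
    aEvenℕ (t + d) t * (suc m ! * (t + d ∸ t) !)
      ≡⟨ cong (λ e → aEvenℕ (t + d) t * (e ! * (t + d ∸ t) !)) (+-comm 1 m) ⟩
    aEvenℕ (t + d) t * ((2 * t + 1) ! * (t + d ∸ t) !) ∎
    where
    p = 2 ^ (2 * t)
    m = 2 * t
    N≡m+d : t + d + t ≡ 2 * t + d
    N≡m+d = solve (t ∷ d ∷ [])
    2[t+d]+1≡2t+2d+1 : 2 * (t + d) + 1 ≡ 2 * t + 2 * d + 1
    2[t+d]+1≡2t+2d+1 = solve (t ∷ d ∷ [])

  bOdd-numerator≡bOddℕ*denominator : ∀ s d →
    2 ^ (2 * s + 1) * ((s + d + suc s) C (2 * s + 1)) * (s + d + 1) ≡ bOddℕ (s + d) (suc s) * suc s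
  bOdd-numerator≡bOddℕ*denominator s d = begin
    q * c * (s + d + 1)
      ≡⟨ split q c s d ⟩
    q * (c * suc s + c * d)
      ≡⟨ cong (λ x → q * (c * suc s + x)) absorb ⟩
    q * (c * suc s + suc m * c′)
      ≡⟨ collect q c c′ s ⟩
    (2 * q * c′ + q * c) * suc s
      ≡⟨ cong₂ (λ e n → (2 ^ e * (N C e) + q * (n C m)) * suc s) 1+m≡2[1+s] N≡s+d+s+1 ⟩
    bOddℕ (s + d) (suc s) * suc s ∎
    where
    m = 2 * s + 1
    N = s + d + suc s
    q = 2 ^ m
    c = N C m
    c′ = N C suc m
    N≡m+d : s + d + suc s ≡ 2 * s + 1 + d
    N≡m+d = solve (s ∷ d ∷ [])
    N≡s+d+s+1 : s + d + suc s ≡ s + d + s + 1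
    N≡s+d+s+1 = solve (s ∷ d ∷ [])
    1+m≡2[1+s] : suc (2 * s + 1) ≡ 2 * suc s
    1+m≡2[1+s] = solve (s ∷ [])
    absorb : c * d ≡ suc m * c′
    absorb = subst (λ n → (n C m) * d ≡ suc m * (n C suc m)) (sym N≡m+d)
                   ([m+d]Cm*d≡[1+m]*[m+d]C[1+m] m d)
    split : ∀ q c s d → q * c * (s + d + 1) ≡ q * (c * (1 + s) + c * d)
    split = solve-∀
    collect : ∀ q c c′ s → q * (c * (1 + s) + (1 + (2 * s + 1)) * c′) ≡ (2 * q * c′ + q * c) * (1 + s)
    collect = solve-∀

  AEvenℕ BEvenℕ AOddℕ BOddℕ : ℕ → ℕ → ℕ
  AEvenℕ ℓ k = eval ℓ (aEvenℕ ℓ) k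
  BEvenℕ ℓ k = eval ℓ (bEvenℕ ℓ) k
  AOddℕ  ℓ k = eval ℓ (aOddℕ ℓ) k
  BOddℕ  ℓ k = eval (suc ℓ) (bOddℕ ℓ) k

  PellEven PellOdd : ℕ → ℕ → ℕ → Set
  PellEven k A B = k * A * A + 1 ≡ (k + 1) * B * B
  PellOdd  k A B = k * (k + 1) * A * A + 1 ≡ B * B

  pellEven⇒pellOdd : ∀ {k A B A′ B′} → PellEven k A B → A′ ≡ A + B → B′ ≡ B + k * A′ → PellOdd k A′ B′
  pellEven⇒pellOdd {k} {A} {B} pell refl refl = begin
    k * (k + 1) * (A + B) * (A + B) + 1                                ≡⟨ expand k A B ⟩
    (k * A * A + 1) + k * (k * (A + B) * (A + B) + 2 * A * B + B * B)  ≡⟨ cong₂ _+_ pell refl ⟩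
    (k + 1) * B * B + k * (k * (A + B) * (A + B) + 2 * A * B + B * B)  ≡⟨ collect k A B ⟩
    (B + k * (A + B)) * (B + k * (A + B))                              ∎
    where
    expand : ∀ k A B → k * (k + 1) * (A + B) * (A + B) + 1
                     ≡ (k * A * A + 1) + k * (k * (A + B) * (A + B) + 2 * A * B + B * B)
    expand = solve-∀
    collect : ∀ k A B → (k + 1) * B * B + k * (k * (A + B) * (A + B) + 2 * A * B + B * B)
                      ≡ (B + k * (A + B)) * (B + k * (A + B))
    collect = solve-∀

  pellOdd⇒pellEven : ∀ {k A B A′ B′} → PellOdd k A B → B′ ≡ B + k * A → A′ ≡ B′ + A → PellEven k A′ B′
  pellOdd⇒pellEven {k} {A} {B} pell refl refl = begin
    k * (B + k * A + A) * (B + k * A + A) + 1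
      ≡⟨ expand k A B ⟩
    (k * (k + 1) * A * A + 1) + k * (B * B + 2 * (k + 1) * A * B + k * (k + 1) * A * A)
      ≡⟨ cong₂ _+_ pell refl ⟩
    B * B + k * (B * B + 2 * (k + 1) * A * B + k * (k + 1) * A * A)
      ≡⟨ collect k A B ⟩
    (k + 1) * (B + k * A) * (B + k * A) ∎
    where
    expand : ∀ k A B → k * (B + k * A + A) * (B + k * A + A) + 1
                     ≡ (k * (k + 1) * A * A + 1) + k * (B * B + 2 * (k + 1) * A * B + k * (k + 1) * A * A)
    expand = solve-∀
    collect : ∀ k A B → B * B + k * (B * B + 2 * (k + 1) * A * B + k * (k + 1) * A * A)
                      ≡ (k + 1) * (B + k * A) * (B + k * A)
    collect = solve-∀

  module _ (k : ℕ) where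

    AOddℕ≡AEvenℕ+BEvenℕ : ∀ ℓ → AOddℕ ℓ k ≡ AEvenℕ ℓ k + BEvenℕ ℓ k
    AOddℕ≡AEvenℕ+BEvenℕ ℓ =
      trans (eval-cong k ℓ (aOddℕ≡aEvenℕ+bEvenℕ ℓ)) (eval-+ k ℓ (aEvenℕ ℓ) (bEvenℕ ℓ))

    BOddℕ≡BEvenℕ+k*AOddℕ : ∀ ℓ → BOddℕ ℓ k ≡ BEvenℕ ℓ k + k * AOddℕ ℓ k
    BOddℕ≡BEvenℕ+k*AOddℕ ℓ = trans (eval-+ k (suc ℓ) (bEvenℕ ℓ) (shift (aOddℕ ℓ)))
      (cong₂ _+_ (eval-extend k ℓ (bEvenℕ ℓ) (bEvenℕ[ℓ,1+ℓ]≡0 ℓ)) (eval-shift k ℓ (aOddℕ ℓ)))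

    BEvenℕ-suc : ∀ ℓ → BEvenℕ (suc ℓ) k ≡ BOddℕ ℓ k + k * AOddℕ ℓ k
    BEvenℕ-suc ℓ = begin
      eval (suc ℓ) (bEvenℕ (suc ℓ)) k
        ≡⟨ eval-cong k (suc ℓ) (bEvenℕ-suc ℓ) ⟩
      eval (suc ℓ) (λ t → bOddℕ ℓ t + shift (aOddℕ ℓ) t) k
        ≡⟨ eval-+ k (suc ℓ) (bOddℕ ℓ) (shift (aOddℕ ℓ)) ⟩
      BOddℕ ℓ k + eval (suc ℓ) (shift (aOddℕ ℓ)) k
        ≡⟨ cong (BOddℕ ℓ k +_) (eval-shift k ℓ (aOddℕ ℓ)) ⟩
      BOddℕ ℓ k + k * AOddℕ ℓ k ∎

    AEvenℕ-suc : ∀ ℓ → AEvenℕ (suc ℓ) k ≡ BEvenℕ (suc ℓ) k + AOddℕ ℓ k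
    AEvenℕ-suc ℓ = begin
      eval (suc ℓ) (aEvenℕ (suc ℓ)) k
        ≡⟨ eval-cong k (suc ℓ) (aEvenℕ-suc ℓ) ⟩
      eval (suc ℓ) (λ t → bEvenℕ (suc ℓ) t + aOddℕ ℓ t) k
        ≡⟨ eval-+ k (suc ℓ) (bEvenℕ (suc ℓ)) (aOddℕ ℓ) ⟩
      BEvenℕ (suc ℓ) k + eval (suc ℓ) (aOddℕ ℓ) k
        ≡⟨ cong (BEvenℕ (suc ℓ) k +_) (eval-extend k ℓ (aOddℕ ℓ) (aOddℕ[ℓ,1+ℓ]≡0 ℓ)) ⟩
      BEvenℕ (suc ℓ) k + AOddℕ ℓ k ∎

    pellEvenℕ : ∀ ℓ → PellEven k (AEvenℕ ℓ k) (BEvenℕ ℓ k)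
    pellOddℕ  : ∀ ℓ → PellOdd k (AOddℕ ℓ k) (BOddℕ ℓ k)
    pellEvenℕ zero    = solve (k ∷ [])
    pellEvenℕ (suc ℓ) =
      pellOdd⇒pellEven {k} {AOddℕ ℓ k} {BOddℕ ℓ k} (pellOddℕ ℓ) (BEvenℕ-suc ℓ) (AEvenℕ-suc ℓ)
    pellOddℕ ℓ =
      pellEven⇒pellOdd {k} {AEvenℕ ℓ k} {BEvenℕ ℓ k} (pellEvenℕ ℓ)
                       (AOddℕ≡AEvenℕ+BEvenℕ ℓ) (BOddℕ≡BEvenℕ+k*AOddℕ ℓ)

    1≤AEvenℕ : ∀ ℓ → 1 ≤ AEvenℕ ℓ k
    1≤AOddℕ  : ∀ ℓ → 1 ≤ AOddℕ ℓ k
    1≤AEvenℕ zero    = ≤-refl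
    1≤AEvenℕ (suc ℓ) =
      subst (1 ≤_) (sym (AEvenℕ-suc ℓ)) (≤-trans (1≤AOddℕ ℓ) (m≤n+m (AOddℕ ℓ k) (BEvenℕ (suc ℓ) k)))
    1≤AOddℕ ℓ =
      subst (1 ≤_) (sym (AOddℕ≡AEvenℕ+BEvenℕ ℓ)) (≤-trans (1≤AEvenℕ ℓ) (m≤m+n (AEvenℕ ℓ k) (BEvenℕ ℓ k)))

open Integral

open import Data.Rational using (ℚ; _+_; _*_; _-_; _/_; 0ℚ; toℚᵘ)
open import Level using (0ℓ)
import Data.Nat as ℕ
import Data.Nat.Properties as ℕ
open import Data.Nat.Properties using (_!*_!≢0)
open import Data.Integer using (+_)
import Data.Integer as ℤ
import Data.Integer.Properties as ℤ
import Data.Rational.Properties as ℚ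
open import Data.Rational.Properties
  using (_≟_; +-*-commutativeRing; toℚᵘ-injective; toℚᵘ-fromℚᵘ; toℚᵘ-homo-+; toℚᵘ-homo-*; fromℚᵘ-cong; /-cong)
open import Data.Rational.Unnormalised using (mkℚᵘ; *≡*)
import Data.Rational.Unnormalised as ℚᵘ
import Data.Rational.Unnormalised.Properties as ℚᵘ
open import Relation.Nullary.Decidable using (dec⇒maybe)
open import Tactic.RingSolver using (solve-∀)
open import Tactic.RingSolver.Core.AlmostCommutativeRing using (AlmostCommutativeRing; fromCommutativeRing)

ℚ-ring : AlmostCommutativeRing 0ℓ 0ℓ
ℚ-ring = fromCommutativeRing +-*-commutativeRing (λ x → dec⇒maybe (0ℚ ≟ x))

toℚᵘ-toℚ : ∀ n → toℚᵘ (toℚ n) ℚᵘ.≃ mkℚᵘ (+ n) 0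
toℚᵘ-toℚ n = toℚᵘ-fromℚᵘ (mkℚᵘ (+ n) 0)

toℚ-+ : ∀ m n → toℚ (m ℕ.+ n) ≡ toℚ m + toℚ n
toℚ-+ m n = toℚᵘ-injective (begin
  toℚᵘ (toℚ (m ℕ.+ n))            ≈⟨ toℚᵘ-toℚ (m ℕ.+ n) ⟩
  mkℚᵘ (+ (m ℕ.+ n)) 0            ≈⟨ *≡* (cong (ℤ._* + 1) (trans (ℤ.pos-+ m n) (sym +m*1+n*1≡+m++n))) ⟩
  mkℚᵘ (+ m) 0 ℚᵘ.+ mkℚᵘ (+ n) 0  ≈⟨ ℚᵘ.+-cong (toℚᵘ-toℚ m) (toℚᵘ-toℚ n) ⟨
  toℚᵘ (toℚ m) ℚᵘ.+ toℚᵘ (toℚ n)  ≈⟨ toℚᵘ-homo-+ (toℚ m) (toℚ n) ⟨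
  toℚᵘ (toℚ m + toℚ n)            ∎)
  where
  open ℚᵘ.≃-Reasoning
  +m*1+n*1≡+m++n : + m ℤ.* + 1 ℤ.+ + n ℤ.* + 1 ≡ + m ℤ.+ + n
  +m*1+n*1≡+m++n = cong₂ ℤ._+_ (ℤ.*-identityʳ (+ m)) (ℤ.*-identityʳ (+ n))

toℚ-* : ∀ m n → toℚ (m ℕ.* n) ≡ toℚ m * toℚ n
toℚ-* m n = toℚᵘ-injective (begin
  toℚᵘ (toℚ (m ℕ.* n))            ≈⟨ toℚᵘ-toℚ (m ℕ.* n) ⟩
  mkℚᵘ (+ (m ℕ.* n)) 0            ≈⟨ *≡* (cong (ℤ._* + 1) (ℤ.pos-* m n)) ⟩
  mkℚᵘ (+ m) 0 ℚᵘ.* mkℚᵘ (+ n) 0  ≈⟨ ℚᵘ.*-cong (toℚᵘ-toℚ m) (toℚᵘ-toℚ n) ⟨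
  toℚᵘ (toℚ m) ℚᵘ.* toℚᵘ (toℚ n)  ≈⟨ toℚᵘ-homo-* (toℚ m) (toℚ n) ⟨
  toℚᵘ (toℚ m * toℚ n)            ∎)
  where open ℚᵘ.≃-Reasoning

open ≡-Reasoning

toℚ-*-* : ∀ a b c → toℚ (a ℕ.* b ℕ.* c) ≡ toℚ a * toℚ b * toℚ c
toℚ-*-* a b c = trans (toℚ-* (a ℕ.* b) c) (cong (_* toℚ c) (toℚ-* a b))

toℚ-∸ : ∀ {m n} → n ≤ m → toℚ (m ℕ.∸ n) ≡ toℚ m - toℚ n
toℚ-∸ {m} {n} n≤m = begin
  toℚ (m ℕ.∸ n)                    ≡⟨ [x+y]-y≡x (toℚ (m ℕ.∸ n)) (toℚ n) ⟨
  toℚ (m ℕ.∸ n) + toℚ n - toℚ n    ≡⟨ cong (_- toℚ n) (toℚ-+ (m ℕ.∸ n) n) ⟨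
  toℚ (m ℕ.∸ n ℕ.+ n) - toℚ n      ≡⟨ cong (λ x → toℚ x - toℚ n) (ℕ.m∸n+n≡m n≤m) ⟩
  toℚ m - toℚ n                    ∎
  where
  [x+y]-y≡x : ∀ x y → x + y - y ≡ x
  [x+y]-y≡x = solve-∀ ℚ-ring

/-exact : ∀ {X} n D .{{_ : ℕ.NonZero D}} → X ≡ n ℕ.* D → (+ X) / D ≡ toℚ n
/-exact {X} n D X≡n*D =
  trans (/-cong {+ X} refl (sym (ℕ.suc-pred D)))
        (fromℚᵘ-cong {mkℚᵘ (+ X) (ℕ.pred D)} {mkℚᵘ (+ n) 0} (*≡* (begin
          + X ℤ.* + 1   ≡⟨ ℤ.*-identityʳ (+ X) ⟩
          + X           ≡⟨ cong +_ (trans X≡n*D (cong (n ℕ.*_) (sym (ℕ.suc-pred D)))) ⟩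
          + (n ℕ.* D′)  ≡⟨ ℤ.pos-* n D′ ⟩
          + n ℤ.* + D′  ∎)))
  where D′ = ℕ.suc (ℕ.pred D)

aEven≡toℚ∘aEvenℕ : ∀ ℓ {t} → t ≤ ℓ → aEven ℓ t ≡ toℚ (aEvenℕ ℓ t)
aEven≡toℚ∘aEvenℕ ℓ {t} t≤ℓ with d , refl ← ℕ.m≤n⇒∃[o]m+o≡n t≤ℓ =
  /-exact (aEvenℕ (t ℕ.+ d) t) _ {{(2 ℕ.* t ℕ.+ 1) !* (t ℕ.+ d ℕ.∸ t) !≢0}}
          (aEven-numerator≡aEvenℕ*denominator t d)

bOdd≡toℚ∘bOddℕ : ∀ ℓ {t} → t ≤ ℕ.suc ℓ → bOdd ℓ t ≡ toℚ (bOddℕ ℓ t)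
bOdd≡toℚ∘bOddℕ ℓ {ℕ.zero}  _ = refl
bOdd≡toℚ∘bOddℕ ℓ {ℕ.suc s} (ℕ.s≤s s≤ℓ) with d , refl ← ℕ.m≤n⇒∃[o]m+o≡n s≤ℓ =
  /-exact (bOddℕ (s ℕ.+ d) (ℕ.suc s)) (ℕ.suc s) (bOdd-numerator≡bOddℕ*denominator s d)

sumTo≡toℚ∘eval : ∀ n k {c : ℕ → ℚ} {cℕ : ℕ → ℕ} → (∀ {t} → t ≤ n → c t ≡ toℚ (cℕ t)) →
                 sumTo n (λ t → c t * toℚ (k ℕ.^ t)) ≡ toℚ (eval n cℕ k)
sumTo≡toℚ∘eval ℕ.zero    k {c} {cℕ} c≡ = trans (cong (_* toℚ 1) (c≡ ℕ.z≤n)) (sym (toℚ-* (cℕ 0) 1))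
sumTo≡toℚ∘eval (ℕ.suc n) k {c} {cℕ} c≡ = begin
  sumTo n (λ t → c t * toℚ (k ℕ.^ t)) + c (ℕ.suc n) * toℚ kⁿ⁺¹
    ≡⟨ cong₂ _+_ (sumTo≡toℚ∘eval n k (λ t≤n → c≡ (ℕ.m≤n⇒m≤1+n t≤n))) (cong (_* toℚ kⁿ⁺¹) (c≡ ℕ.≤-refl)) ⟩
  toℚ (eval n cℕ k) + toℚ (cℕ (ℕ.suc n)) * toℚ kⁿ⁺¹
    ≡⟨ cong (λ x → toℚ (eval n cℕ k) + x) (toℚ-* (cℕ (ℕ.suc n)) kⁿ⁺¹) ⟨
  toℚ (eval n cℕ k) + toℚ (cℕ (ℕ.suc n) ℕ.* kⁿ⁺¹)
    ≡⟨ toℚ-+ (eval n cℕ k) (cℕ (ℕ.suc n) ℕ.* kⁿ⁺¹) ⟨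
  toℚ (eval (ℕ.suc n) cℕ k) ∎
  where kⁿ⁺¹ = k ℕ.^ ℕ.suc n

module _ (ℓ k : ℕ) where

  AEven≡toℚ∘AEvenℕ : AEven ℓ k ≡ toℚ (AEvenℕ ℓ k)
  AEven≡toℚ∘AEvenℕ = sumTo≡toℚ∘eval ℓ k (aEven≡toℚ∘aEvenℕ ℓ)

  BEven≡toℚ∘BEvenℕ : BEven ℓ k ≡ toℚ (BEvenℕ ℓ k)
  BEven≡toℚ∘BEvenℕ = sumTo≡toℚ∘eval ℓ k (λ _ → refl)

  AOdd≡toℚ∘AOddℕ : AOdd ℓ k ≡ toℚ (AOddℕ ℓ k)
  AOdd≡toℚ∘AOddℕ = sumTo≡toℚ∘eval ℓ k (λ _ → refl)

  BOdd≡toℚ∘BOddℕ : BOdd ℓ k ≡ toℚ (BOddℕ ℓ k)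
  BOdd≡toℚ∘BOddℕ = sumTo≡toℚ∘eval (ℕ.suc ℓ) k (bOdd≡toℚ∘bOddℕ ℓ)

k+[x-k]≡x : ∀ k x → k + (x - k) ≡ x
k+[x-k]≡x = solve-∀ ℚ-ring

Π≡square : ∀ k j p q a b →
           p * q ≡ k * (k + toℚ 1) → k + j ≡ p * a * a → k + j + toℚ 1 ≡ q * b * b →
           Π k j ≡ (k * (k + toℚ 1) * a * b) * (k * (k + toℚ 1) * a * b)
Π≡square k j p q a b pq≡k[k+1] k+j≡paa k+j+1≡qbb = begin
  k * (k + toℚ 1) * (k + j) * (k + j + toℚ 1)
    ≡⟨ cong₂ (λ u v → k * (k + toℚ 1) * u * v) k+j≡paa k+j+1≡qbb ⟩
  k * (k + toℚ 1) * (p * a * a) * (q * b * b)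
    ≡⟨ regroup k p q a b ⟩
  k * (k + toℚ 1) * (p * q) * (a * b) * (a * b)
    ≡⟨ cong (λ m → k * (k + toℚ 1) * m * (a * b) * (a * b)) pq≡k[k+1] ⟩
  k * (k + toℚ 1) * (k * (k + toℚ 1)) * (a * b) * (a * b)
    ≡⟨ square k a b ⟩
  (k * (k + toℚ 1) * a * b) * (k * (k + toℚ 1) * a * b) ∎
  where
  regroup : ∀ k p q a b → k * (k + toℚ 1) * (p * a * a) * (q * b * b)
                        ≡ k * (k + toℚ 1) * (p * q) * (a * b) * (a * b)
  regroup = solve-∀ ℚ-ring
  square : ∀ k a b → k * (k + toℚ 1) * (k * (k + toℚ 1)) * (a * b) * (a * b)
                   ≡ (k * (k + toℚ 1) * a * b) * (k * (k + toℚ 1) * a * b)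
  square = solve-∀ ℚ-ring

evenCase : ∀ ℓ k →
    (toℚ k + jEven ℓ k + toℚ 1 ≡ toℚ k * AEven ℓ k * AEven ℓ k + toℚ 1)
    × (toℚ k * AEven ℓ k * AEven ℓ k + toℚ 1 ≡ (toℚ k + toℚ 1) * BEven ℓ k * BEven ℓ k)
    × (∃ λ (n : ℕ) → jEven ℓ k ≡ toℚ n)
    × (Π (toℚ k) (jEven ℓ k)
        ≡ (toℚ k * (toℚ k + toℚ 1) * AEven ℓ k * BEven ℓ k)
          * (toℚ k * (toℚ k + toℚ 1) * AEven ℓ k * BEven ℓ k))
evenCase ℓ k =
  k+j+1≡x+1 , pell , (X ℕ.∸ k , j≡toℚ[X∸k]) , Π≡square κ j κ (κ + toℚ 1) a b refl k+j≡x (trans k+j+1≡x+1 pell)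
  where
  κ = toℚ k
  j = jEven ℓ k
  a = AEven ℓ k
  b = BEven ℓ k
  A = AEvenℕ ℓ k
  B = BEvenℕ ℓ k
  X = k ℕ.* A ℕ.* A
  k+j≡x : κ + j ≡ κ * a * a
  k+j≡x = k+[x-k]≡x κ (κ * a * a)
  k+j+1≡x+1 : κ + j + toℚ 1 ≡ κ * a * a + toℚ 1
  k+j+1≡x+1 = cong (_+ toℚ 1) k+j≡x
  x≡toℚX : κ * a * a ≡ toℚ X
  x≡toℚX = trans (cong (λ a → κ * a * a) (AEven≡toℚ∘AEvenℕ ℓ k)) (sym (toℚ-*-* k A A))
  pell : κ * a * a + toℚ 1 ≡ (κ + toℚ 1) * b * b
  pell = begin
    κ * a * a + toℚ 1              ≡⟨ cong (_+ toℚ 1) x≡toℚX ⟩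
    toℚ X + toℚ 1                  ≡⟨ toℚ-+ X 1 ⟨
    toℚ (X ℕ.+ 1)                  ≡⟨ cong toℚ (pellEvenℕ k ℓ) ⟩
    toℚ ((k ℕ.+ 1) ℕ.* B ℕ.* B)    ≡⟨ toℚ-*-* (k ℕ.+ 1) B B ⟩
    toℚ (k ℕ.+ 1) * toℚ B * toℚ B  ≡⟨ cong₂ (λ c b → c * b * b) (toℚ-+ k 1) (sym (BEven≡toℚ∘BEvenℕ ℓ k)) ⟩
    (κ + toℚ 1) * b * b            ∎
  k≤X : k ℕ.≤ X
  k≤X = ℕ.≤-trans (ℕ.m≤m*n k A) (ℕ.m≤m*n (k ℕ.* A) A)
    where instance _ = ℕ.>-nonZero (1≤AEvenℕ k ℓ)
  j≡toℚ[X∸k] : j ≡ toℚ (X ℕ.∸ k)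
  j≡toℚ[X∸k] = trans (cong (_- κ) x≡toℚX) (sym (toℚ-∸ k≤X))

oddCase : ∀ ℓ k →
    (toℚ k + jOdd ℓ k + toℚ 1 ≡ toℚ k * (toℚ k + toℚ 1) * AOdd ℓ k * AOdd ℓ k + toℚ 1)
    × (toℚ k * (toℚ k + toℚ 1) * AOdd ℓ k * AOdd ℓ k + toℚ 1 ≡ BOdd ℓ k * BOdd ℓ k)
    × (∃ λ (n : ℕ) → jOdd ℓ k ≡ toℚ n)
    × (Π (toℚ k) (jOdd ℓ k)
        ≡ (toℚ k * (toℚ k + toℚ 1) * AOdd ℓ k * BOdd ℓ k)
          * (toℚ k * (toℚ k + toℚ 1) * AOdd ℓ k * BOdd ℓ k))
oddCase ℓ k =
  k+j+1≡x+1 , pell , (X ℕ.∸ k , j≡toℚ[X∸k]) ,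
  Π≡square κ j (κ * (κ + toℚ 1)) (toℚ 1) a b (ℚ.*-identityʳ (κ * (κ + toℚ 1))) k+j≡x k+j+1≡1*b*b
  where
  κ = toℚ k
  j = jOdd ℓ k
  a = AOdd ℓ k
  b = BOdd ℓ k
  A = AOddℕ ℓ k
  B = BOddℕ ℓ k
  X = k ℕ.* (k ℕ.+ 1) ℕ.* A ℕ.* A
  k+j≡x : κ + j ≡ κ * (κ + toℚ 1) * a * a
  k+j≡x = k+[x-k]≡x κ (κ * (κ + toℚ 1) * a * a)
  k+j+1≡x+1 : κ + j + toℚ 1 ≡ κ * (κ + toℚ 1) * a * a + toℚ 1
  k+j+1≡x+1 = cong (_+ toℚ 1) k+j≡x
  x≡toℚX : κ * (κ + toℚ 1) * a * a ≡ toℚ X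
  x≡toℚX = begin
    κ * (κ + toℚ 1) * a * a
      ≡⟨ cong₂ (λ c a → κ * c * a * a) (toℚ-+ k 1) (sym (AOdd≡toℚ∘AOddℕ ℓ k)) ⟨
    κ * toℚ (k ℕ.+ 1) * toℚ A * toℚ A
      ≡⟨ cong (λ c → c * toℚ A * toℚ A) (toℚ-* k (k ℕ.+ 1)) ⟨
    toℚ (k ℕ.* (k ℕ.+ 1)) * toℚ A * toℚ A
      ≡⟨ toℚ-*-* (k ℕ.* (k ℕ.+ 1)) A A ⟨
    toℚ X ∎
  pell : κ * (κ + toℚ 1) * a * a + toℚ 1 ≡ b * b
  pell = begin
    κ * (κ + toℚ 1) * a * a + toℚ 1  ≡⟨ cong (_+ toℚ 1) x≡toℚX ⟩
    toℚ X + toℚ 1                    ≡⟨ toℚ-+ X 1 ⟨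
    toℚ (X ℕ.+ 1)                    ≡⟨ cong toℚ (pellOddℕ k ℓ) ⟩
    toℚ (B ℕ.* B)                    ≡⟨ toℚ-* B B ⟩
    toℚ B * toℚ B                    ≡⟨ cong (λ b → b * b) (BOdd≡toℚ∘BOddℕ ℓ k) ⟨
    b * b                            ∎
  k+j+1≡1*b*b : κ + j + toℚ 1 ≡ toℚ 1 * b * b
  k+j+1≡1*b*b = trans (trans k+j+1≡x+1 pell) (cong (_* b) (sym (ℚ.*-identityˡ b)))
  k≤X : k ℕ.≤ X
  k≤X = ℕ.≤-trans (ℕ.m≤m*n k (k ℕ.+ 1))
          (ℕ.≤-trans (ℕ.m≤m*n (k ℕ.* (k ℕ.+ 1)) A) (ℕ.m≤m*n (k ℕ.* (k ℕ.+ 1) ℕ.* A) A))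
    where instance
      _ = ℕ.>-nonZero (ℕ.m≤n+m 1 k)
      _ = ℕ.>-nonZero (1≤AOddℕ k ℓ)
  j≡toℚ[X∸k] : j ≡ toℚ (X ℕ.∸ k)
  j≡toℚ[X∸k] = trans (cong (_- κ) x≡toℚX) (sym (toℚ-∸ k≤X))

mainTheorem9 : ((ℓ : ℕ) → 1 ≤ ℓ → (k : ℕ) → 1 ≤ k →
      (toℚ k + jEven ℓ k + toℚ 1 ≡ toℚ k * AEven ℓ k * AEven ℓ k + toℚ 1)
      × (toℚ k * AEven ℓ k * AEven ℓ k + toℚ 1 ≡ (toℚ k + toℚ 1) * BEven ℓ k * BEven ℓ k)
      × (∃ λ (n : ℕ) → jEven ℓ k ≡ toℚ n)
      × (Π (toℚ k) (jEven ℓ k)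
          ≡ (toℚ k * (toℚ k + toℚ 1) * AEven ℓ k * BEven ℓ k)
            * (toℚ k * (toℚ k + toℚ 1) * AEven ℓ k * BEven ℓ k)))
    ×
    ((ℓ : ℕ) → (k : ℕ) → 1 ≤ k →
      (toℚ k + jOdd ℓ k + toℚ 1 ≡ toℚ k * (toℚ k + toℚ 1) * AOdd ℓ k * AOdd ℓ k + toℚ 1)
      × (toℚ k * (toℚ k + toℚ 1) * AOdd ℓ k * AOdd ℓ k + toℚ 1 ≡ BOdd ℓ k * BOdd ℓ k)
      × (∃ λ (n : ℕ) → jOdd ℓ k ≡ toℚ n)
      × (Π (toℚ k) (jOdd ℓ k)
          ≡ (toℚ k * (toℚ k + toℚ 1) * AOdd ℓ k * BOdd ℓ k)
            * (toℚ k * (toℚ k + toℚ 1) * AOdd ℓ k * BOdd ℓ k)))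
mainTheorem9 = (λ ℓ _ k _ → evenCase ℓ k) , (λ ℓ k _ → oddCase ℓ k)
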